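{- For every odd $m\in\mathbb N$, $I_{\{0,1\}}(\mathrm{Bal}_m)=I_{\{0,1\}}(\mathrm{Cat}_m)$.
   Context: An $m$-ary polymorphism pattern over a variable set $V$ is a set of pairs $((v_1,\dots,v_m),v)$ with $v_i,v\in V$. For a finite set $D$, $I_D(P)$ is the set of partial functions $f$ from $D^m$ to $D$ such that for every $((v_1,\dots,v_m),v)\in P$ and every $g:\{v_1,\dots,v_m,v\}\to D$, $(g(v_1),\dots,g(v_m))$ is in the domain of $f$ and, when $v\in\{v_1,\dots,v_m\}$, $f(g(v_1),\dots,g(v_m))=g(v)$; $f$ is undefined elsewhere. $\mathrm{Bal}_m$ is the pattern over $\{x,y\}$ consisting of all $((v_1,\dots,v_m),v)$ with $v_i,v\in\{x,y\}$ and $\eta(v_1)-\eta(v_2)+\eta(v_3)-\dots+\eta(v_m)=\eta(v)$ in $\mathbb Z$, where $\eta(x)=0,\eta(y)=1$. With $V$ countably infinite and $\mathrm{Cox}(V)$ the group generated by $V$ subject to $v^2=1$ for all $v$, $\mathrm{Cat}_m$ is the pattern over $V$ consisting of all $((v_1,\dots,v_m),v)$ with $v_1v_2^{ -1}v_3\cdots v_{m-1}^{ -1}v_m=v$ in $\mathrm{Cox}(V)$. -}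

module Defs where

open import Data.Nat using (ℕ; zero; suc; _*_)
open import Data.Bool using (Bool; true; false)
open import Data.Integer using (ℤ; _-_; 0ℤ; 1ℤ)
open import Data.Maybe using (Maybe; just; nothing)
open import Data.Vec using (Vec; []; _∷_; map)
open import Data.Vec.Membership.Propositional using (_∈_)
open import Data.List using (List; []; _∷_; [_]; _++_)
open import Data.Product using (Σ; ∃; _×_; _,_)
open import Relation.Binary.PropositionalEquality using (_≡_; _≢_)
open import Relation.Binary.Construct.Closure.Equivalence using (EqClosure)
open import Relation.Nullary using (¬_)
open import Function.Bundles using (_⇔_)

Odd : ℕ → Set
Odd m = ∃ λ k → m ≡ suc (2 * k)

-- An m-ary polymorphism pattern over V: a set of pairs ((v₁,…,vₘ), v),
-- represented as a predicate.
Pattern : Set → ℕ → Set₁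
Pattern V m = Vec V m → V → Set

PFun : Set → ℕ → Set
PFun D m = Vec D m → Maybe D

InDomOf : {V D : Set} {m : ℕ} → Pattern V m → Vec D m → Set
InDomOf {V} {D} P t = Σ (Vec V _) λ vs → Σ V λ v → P vs v × Σ (V → D) λ g → map g vs ≡ t

record InI {V : Set} (D : Set) {m : ℕ} (P : Pattern V m) (f : PFun D m) : Set where
  field
    defined   : ∀ vs v → P vs v → (g : V → D) → ∃ λ d → f (map g vs) ≡ just d
    projects  : ∀ vs v → P vs v → (g : V → D) → v ∈ vs → f (map g vs) ≡ just (g v)
    undefined : (t : Vec D m) → ¬ InDomOf P t → f t ≡ nothing

-- Bal_m over {x, y} = Bool with x = false, y = true

η : Bool → ℤ
η false = 0ℤ
η true  = 1ℤ

altSum : {m : ℕ} → Vec Bool m → ℤ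
altSum []       = 0ℤ
altSum (a ∷ as) = η a - altSum as

Bal : (m : ℕ) → Pattern Bool m
Bal m vs v = altSum vs ≡ η v

-- Cox(V) for V = ℕ: the group ⟨ V | v² = 1 ⟩, presented as the monoid on
-- letters v, v⁻¹ (v ∈ V) with relations v v⁻¹ = 1, v⁻¹ v = 1, v v = 1.

-- (v , false) is the letter v, (v , true) is v⁻¹.
Letter : Set
Letter = ℕ × Bool

inv : Letter → Letter
inv (v , false) = (v , true)
inv (v , true)  = (v , false)

data CoxStep : List Letter → List Letter → Set where
  cancel : ∀ u a w → CoxStep (u ++ a ∷ inv a ∷ w) (u ++ w)
  square : ∀ u v w → CoxStep (u ++ (v , false) ∷ (v , false) ∷ w) (u ++ w)

_≈Cox_ : List Letter → List Letter → Set
_≈Cox_ = EqClosure CoxStep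

altWord : {m : ℕ} → Vec ℕ m → Bool → List Letter
altWord []       s = []
altWord (a ∷ as) false = (a , false) ∷ altWord as true
altWord (a ∷ as) true  = (a , true)  ∷ altWord as false

Cat : (m : ℕ) → Pattern ℕ m
Cat m vs v = altWord vs false ≈Cox [ (v , false) ]

-- Call R generated by P when R consists exactly of the images of the pairs
-- of P under assignments of the variables, each pair of R being the image of
-- a pair whose output variable occurs among its inputs. Then I(P) consists of
-- the partial functions sending t to b whenever R t b and undefined wherever R
-- prescribes no value. For odd m both Bal_m and Cat_m generate Bal_m. Letting
-- every letter act on ℤ by the reflection z ↦ η(g v) − z shows that Cat-pairs
-- are sent to Bal-pairs. Conversely, a Bal-pair (t, b), read as a word in x
-- and y, reduces in Cox to the letter b: cancel adjacent equal letters until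
-- the word alternates, and note that an alternating word of odd length ≥ 3
-- has alternating sum outside {0,1}. That Bal is closed under assignments
-- then follows by passing through Cat, and the output variable occurs among
-- the inputs because otherwise the assignment sending only it to 1 would
-- violate Bal.
module Submission where

open import Defs
open import Data.Nat using (ℕ; zero; suc; _*_; _+_)
open import Data.Nat.Properties using (*-suc; suc-injective)
import Data.Nat as ℕ
open import Data.Bool using (Bool; true; false; not)
import Data.Bool as Bool
open import Data.Integer using (ℤ; _-_; +_; -[1+_]; 0ℤ; 1ℤ)
open import Data.Integer.Properties using (+-identityʳ)
open import Data.Integer.Tactic.RingSolver using (solve-∀)
open import Data.Maybe using (just; nothing)
open import Data.Vec using (Vec; []; _∷_; map; toList)
open import Data.Vec.Properties using (map-id; map-∘; map-cong; length-toList)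
open import Data.Vec.Membership.Propositional using (_∈_; _∉_)
open import Data.Vec.Relation.Unary.Any using (here; there)
open import Data.List using (List; []; _∷_; [_]; _++_; length)
open import Data.List.Properties using (∷-injectiveˡ; length-++-sucʳ)
open import Data.Product using (∃; ∃₂; _,_)
open import Data.Sum using (_⊎_; inj₁; inj₂)
open import Data.Empty using (⊥-elim)
open import Function using (_∘_; id)
open import Function.Bundles using (_⇔_; mk⇔)
open import Function.Construct.Composition using (_⇔-∘_)
open import Function.Construct.Symmetry using (⇔-sym)
open import Relation.Binary.Definitions using (DecidableEquality)
open import Relation.Binary.Bundles using (Setoid)
open import Relation.Binary.PropositionalEquality
  using (_≡_; _≢_; refl; sym; trans; cong; subst; subst₂; _→-setoid_; module ≡-Reasoning)
open import Relation.Binary.Construct.Closure.Equivalence using (gfold)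
open import Relation.Binary.Construct.Closure.ReflexiveTransitive using (ε; _◅_)
open import Relation.Binary.Construct.Closure.Symmetric using (fwd)
open import Relation.Nullary using (¬_; does)
open import Relation.Nullary.Decidable using (decidable-stable; dec-true; dec-false)

record DeterminedBy {D : Set} {m : ℕ} (R : Pattern D m) (f : PFun D m) : Set where
  field
    defined   : ∀ {t b} → R t b → f t ≡ just b
    undefined : ∀ t → (∀ b → ¬ R t b) → f t ≡ nothing

module _ {V D : Set} {m : ℕ} where

  record Instance (P : Pattern V m) (t : Vec D m) (b : D) : Set where
    field
      vars       : Vec V m
      var        : V
      holds      : P vars var
      assignment : V → D
      vars↦t     : map assignment vars ≡ t
      var↦b      : assignment var ≡ b
      var∈vars   : var ∈ vars

  record Generates (P : Pattern V m) (R : Pattern D m) : Set where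
    field
      sound    : ∀ {vs v} → P vs v → (g : V → D) → R (map g vs) (g v)
      complete : ∀ {t b} → R t b → Instance P t b

  InI⇔DeterminedBy : {P : Pattern V m} {R : Pattern D m} → Generates P R →
                     (f : PFun D m) → InI D P f ⇔ DeterminedBy R f
  InI⇔DeterminedBy {P} {R} gen f = mk⇔ to from
    where
    open Generates gen

    instance-in-dom : ∀ {t b} → R t b → InDomOf P t
    instance-in-dom r = let open Instance (complete r) in
      vars , var , holds , assignment , vars↦t

    to : InI D P f → DeterminedBy R f
    to I = record
      { defined   = forced
      ; undefined = λ t ¬R → InI.undefined I t λ (vs , v , p , g , g[vs]≡t) →
                      ¬R (g v) (subst (λ s → R s (g v)) g[vs]≡t (sound p g))
      }
      where
      forced : ∀ {t b} → R t b → f t ≡ just b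
      forced r with complete r
      ... | record { vars = vs ; var = v ; holds = p ; assignment = g
                   ; vars↦t = refl ; var↦b = refl ; var∈vars = v∈vs } =
        InI.projects I vs v p g v∈vs

    from : DeterminedBy R f → InI D P f
    from F = record
      { defined   = λ vs v p g → g v , DeterminedBy.defined F (sound p g)
      ; projects  = λ vs v p g _ → DeterminedBy.defined F (sound p g)
      ; undefined = λ t ¬dom → DeterminedBy.undefined F t λ b r → ¬dom (instance-in-dom r)
      }

act : (ℕ → Bool) → List Letter → ℤ → ℤ
act g []              z = z
act g ((v , _) ∷ w) z = η (g v) - act g w z

reflection-involutive : ∀ c z → c - (c - z) ≡ z
reflection-involutive = solve-∀

act-++ : ∀ g u w z → act g (u ++ w) z ≡ act g u (act g w z)
act-++ g []              w z = refl
act-++ g ((v , _) ∷ u) w z = cong (η (g v) -_) (act-++ g u w z)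

act-deletes-pair : ∀ g u v s s′ w z →
  act g (u ++ (v , s) ∷ (v , s′) ∷ w) z ≡ act g (u ++ w) z
act-deletes-pair g u v s s′ w z = begin
  act g (u ++ (v , s) ∷ (v , s′) ∷ w) z     ≡⟨ act-++ g u _ z ⟩
  act g u (η (g v) - (η (g v) - act g w z)) ≡⟨ cong (act g u) (reflection-involutive (η (g v)) _) ⟩
  act g u (act g w z)                       ≡⟨ act-++ g u w z ⟨
  act g (u ++ w) z                          ∎
  where open ≡-Reasoning

act-respects-CoxStep : ∀ g {w w′} → CoxStep w w′ → ∀ z → act g w z ≡ act g w′ z
act-respects-CoxStep g (cancel u (v , false) w) = act-deletes-pair g u v false true w
act-respects-CoxStep g (cancel u (v , true) w)  = act-deletes-pair g u v true false w
act-respects-CoxStep g (square u v w)           = act-deletes-pair g u v false false w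

act-respects-≈Cox : ∀ g {w w′} → w ≈Cox w′ → ∀ z → act g w z ≡ act g w′ z
act-respects-≈Cox g = gfold (Setoid.isEquivalence (ℤ →-setoid ℤ)) (act g) (act-respects-CoxStep g)

act-altWord : ∀ g {n} (vs : Vec ℕ n) s → act g (altWord vs s) 0ℤ ≡ altSum (map g vs)
act-altWord g []       s     = refl
act-altWord g (v ∷ vs) false = cong (η (g v) -_) (act-altWord g vs true)
act-altWord g (v ∷ vs) true  = cong (η (g v) -_) (act-altWord g vs false)

Cat-sound : ∀ {m vs v} → Cat m vs v → (g : ℕ → Bool) → Bal m (map g vs) (g v)
Cat-sound {vs = vs} {v} c g = begin
  altSum (map g vs)              ≡⟨ act-altWord g vs false ⟨
  act g (altWord vs false) 0ℤ    ≡⟨ act-respects-≈Cox g c 0ℤ ⟩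
  η (g v) - 0ℤ                   ≡⟨ +-identityʳ (η (g v)) ⟩
  η (g v)                        ∎
  where open ≡-Reasoning

module _ {V : Set} (_≟_ : DecidableEquality V) where
  open import Data.Vec.Membership.DecPropositional _≟_ using (_∈?_)

  Bal-stable⇒∈ : ∀ {m} {vs : Vec V m} {v} →
                 (∀ (g : V → Bool) → Bal m (map g vs) (g v)) → v ∈ vs
  Bal-stable⇒∈ {vs = vs} {v} stable = decidable-stable (v ∈? vs) λ v∉vs →
    0≢1 (trans (sym (altSum-indicator v∉vs)) (trans (stable indicator) indicator-v))
    where
    indicator : V → Bool
    indicator x = does (x ≟ v)

    indicator-v : η (indicator v) ≡ 1ℤ
    indicator-v = cong η (dec-true (v ≟ v) refl)

    altSum-indicator : ∀ {n} {xs : Vec V n} → v ∉ xs → altSum (map indicator xs) ≡ 0ℤ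
    altSum-indicator {xs = []}     v∉xs = refl
    altSum-indicator {xs = x ∷ xs} v∉xs
      rewrite dec-false (x ≟ v) (v∉xs ∘ here ∘ sym)
            | altSum-indicator (v∉xs ∘ there) = refl

    0≢1 : 0ℤ ≢ 1ℤ
    0≢1 ()

encode : Bool → ℕ
encode false = 0
encode true  = 1

decode : ℕ → Bool
decode zero    = false
decode (suc _) = true

decode-encode : ∀ b → decode (encode b) ≡ b
decode-encode false = refl
decode-encode true  = refl

map-decode-encode : ∀ {n} (t : Vec Bool n) → map decode (map encode t) ≡ t
map-decode-encode t = trans (sym (map-∘ decode encode t)) (trans (map-cong decode-encode t) (map-id t))

-- Cancelling letters changes the length, so the reduction works on lists.
altSumList : List Bool → ℤ
altSumList []      = 0ℤ
altSumList (a ∷ t) = η a - altSumList t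

encodedWord : List Bool → Bool → List Letter
encodedWord []      s = []
encodedWord (a ∷ t) s = (encode a , s) ∷ encodedWord t (not s)

altSum-toList : ∀ {n} (t : Vec Bool n) → altSum t ≡ altSumList (toList t)
altSum-toList []      = refl
altSum-toList (a ∷ t) = cong (η a -_) (altSum-toList t)

altWord-toList : ∀ {n} (t : Vec Bool n) s → altWord (map encode t) s ≡ encodedWord (toList t) s
altWord-toList []      s     = refl
altWord-toList (a ∷ t) false = cong ((encode a , false) ∷_) (altWord-toList t true)
altWord-toList (a ∷ t) true  = cong ((encode a , true) ∷_) (altWord-toList t false)

CoxStep-cons : ∀ l {w w′} → CoxStep w w′ → CoxStep (l ∷ w) (l ∷ w′)
CoxStep-cons l (cancel u a w) = cancel (l ∷ u) a w
CoxStep-cons l (square u v w) = square (l ∷ u) v w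

encodedWord-deletes-pair : ∀ u a w s →
  CoxStep (encodedWord (u ++ a ∷ a ∷ w) s) (encodedWord (u ++ w) s)
encodedWord-deletes-pair []      a w false = cancel [] (encode a , false) (encodedWord w false)
encodedWord-deletes-pair []      a w true  = cancel [] (encode a , true) (encodedWord w true)
encodedWord-deletes-pair (c ∷ u) a w s     = CoxStep-cons (encode c , s) (encodedWord-deletes-pair u a w (not s))

altSumList-deletes-pair : ∀ u a w → altSumList (u ++ a ∷ a ∷ w) ≡ altSumList (u ++ w)
altSumList-deletes-pair []      a w = reflection-involutive (η a) (altSumList w)
altSumList-deletes-pair (c ∷ u) a w = cong (η c -_) (altSumList-deletes-pair u a w)

AdjacentPair : List Bool → Set
AdjacentPair t = ∃₂ λ u a → ∃ λ w → t ≡ u ++ a ∷ a ∷ w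

alternating : Bool → ℕ → List Bool
alternating a zero    = []
alternating a (suc n) = a ∷ alternating (not a) n

Alternating : List Bool → Set
Alternating t = ∃ λ a → t ≡ alternating a (length t)

AdjacentPair⊎Alternating-∷ : ∀ a {t} → AdjacentPair (not a ∷ t) ⊎ Alternating (not a ∷ t) →
                             AdjacentPair (a ∷ not a ∷ t) ⊎ Alternating (a ∷ not a ∷ t)
AdjacentPair⊎Alternating-∷ a (inj₁ (u , c , w , eq)) = inj₁ (a ∷ u , c , w , cong (a ∷_) eq)
AdjacentPair⊎Alternating-∷ a {t} (inj₂ (c , eq)) =
  inj₂ (a , cong (a ∷_) (trans eq (cong (λ c → alternating c (suc (length t))) (sym (∷-injectiveˡ eq)))))

adjacentPair-or-alternating : ∀ t → AdjacentPair t ⊎ Alternating t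
adjacentPair-or-alternating []                  = inj₂ (false , refl)
adjacentPair-or-alternating (a ∷ [])            = inj₂ (a , refl)
adjacentPair-or-alternating (false ∷ false ∷ t) = inj₁ ([] , false , t , refl)
adjacentPair-or-alternating (true ∷ true ∷ t)   = inj₁ ([] , true , t , refl)
adjacentPair-or-alternating (false ∷ true ∷ t)  =
  AdjacentPair⊎Alternating-∷ false (adjacentPair-or-alternating (true ∷ t))
adjacentPair-or-alternating (true ∷ false ∷ t)  =
  AdjacentPair⊎Alternating-∷ true (adjacentPair-or-alternating (false ∷ t))

altSumList-alternating-false : ∀ k → altSumList (alternating false (3 + 2 * k)) ≡ -[1+ k ]
altSumList-alternating-false zero = refl
altSumList-alternating-false (suc k) =
  trans (cong (λ n → altSumList (alternating false (3 + n))) (*-suc 2 k))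
        (cong (λ x → 0ℤ - (1ℤ - x)) (altSumList-alternating-false k))

altSumList-alternating-true : ∀ k → altSumList (alternating true (3 + 2 * k)) ≡ + (2 + k)
altSumList-alternating-true zero = refl
altSumList-alternating-true (suc k) =
  trans (cong (λ n → altSumList (alternating true (3 + n))) (*-suc 2 k))
        (cong (λ x → 1ℤ - (0ℤ - x)) (altSumList-alternating-true k))

alternating-not-Bal : ∀ a k b → altSumList (alternating a (3 + 2 * k)) ≢ η b
alternating-not-Bal false k b eq = η≢-[1+ b ] (trans (sym eq) (altSumList-alternating-false k))
  where
  η≢-[1+_] : ∀ b → η b ≢ -[1+ k ]
  η≢-[1+ false ] ()
  η≢-[1+ true ] ()
alternating-not-Bal true k b eq = η≢2+k b (trans (sym eq) (altSumList-alternating-true k))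
  where
  η≢2+k : ∀ b → η b ≢ + (2 + k)
  η≢2+k false ()
  η≢2+k true ()

encodedWord-reduces : ∀ k t b → length t ≡ suc (2 * k) → altSumList t ≡ η b →
                      encodedWord t false ≈Cox [ (encode b , false) ]
encodedWord-reduces zero    (false ∷ []) false _ _  = ε
encodedWord-reduces zero    (true ∷ [])  true  _ _  = ε
encodedWord-reduces zero    (false ∷ []) true  _ ()
encodedWord-reduces zero    (true ∷ [])  false _ ()
encodedWord-reduces zero    []           _     () _
encodedWord-reduces zero    (_ ∷ _ ∷ _)  _     () _
encodedWord-reduces (suc k) t b len sum
  with adjacentPair-or-alternating t | trans len (cong suc (*-suc 2 k))
... | inj₁ (u , a , w , refl) | len′ =
  fwd (encodedWord-deletes-pair u a w false) ◅
  encodedWord-reduces k (u ++ w) b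
    (suc-injective (suc-injective (begin
      suc (suc (length (u ++ w)))  ≡⟨ cong suc (length-++-sucʳ u a w) ⟨
      suc (length (u ++ a ∷ w))    ≡⟨ length-++-sucʳ u a (a ∷ w) ⟨
      length (u ++ a ∷ a ∷ w)      ≡⟨ len′ ⟩
      3 + 2 * k                    ∎)))
    (trans (sym (altSumList-deletes-pair u a w)) sum)
  where open ≡-Reasoning
... | inj₂ (a , t-alt) | len′ =
  ⊥-elim (alternating-not-Bal a k b
    (subst (λ s → altSumList s ≡ η b) (trans t-alt (cong (alternating a) len′)) sum))

Cat-complete : ∀ {m t b} → Odd m → Bal m t b → Cat m (map encode t) (encode b)
Cat-complete {t = t} {b} (k , refl) bal =
  subst (_≈Cox [ (encode b , false) ]) (sym (altWord-toList t false))
    (encodedWord-reduces k (toList t) b (length-toList t) (trans (sym (altSum-toList t)) bal))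

Bal-substitution : ∀ {m vs v} → Odd m → Bal m vs v → (g : Bool → Bool) → Bal m (map g vs) (g v)
Bal-substitution {m} {vs} {v} odd bal g =
  subst₂ (Bal m) map-g∘decode-encode (cong g (decode-encode v))
    (Cat-sound {vs = map encode vs} (Cat-complete {t = vs} odd bal) (g ∘ decode))
  where
  map-g∘decode-encode : map (g ∘ decode) (map encode vs) ≡ map g vs
  map-g∘decode-encode = trans (map-∘ g decode (map encode vs)) (cong (map g) (map-decode-encode vs))

Bal-generates-Bal : ∀ {m} → Odd m → Generates (Bal m) (Bal m)
Bal-generates-Bal odd = record
  { sound    = λ {vs} → Bal-substitution {vs = vs} odd
  ; complete = λ {t} {b} bal → record
    { vars = t ; var = b ; holds = bal ; assignment = id
    ; vars↦t = map-id t ; var↦b = refl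
    ; var∈vars = Bal-stable⇒∈ Bool._≟_ (Bal-substitution {vs = t} odd bal)
    }
  }

Cat-generates-Bal : ∀ {m} → Odd m → Generates (Cat m) (Bal m)
Cat-generates-Bal odd = record
  { sound    = λ {vs} → Cat-sound {vs = vs}
  ; complete = λ {t} {b} bal → record
    { vars = map encode t ; var = encode b ; holds = Cat-complete {t = t} odd bal ; assignment = decode
    ; vars↦t = map-decode-encode t ; var↦b = decode-encode b
    ; var∈vars = Bal-stable⇒∈ ℕ._≟_ (Cat-sound {vs = map encode t} (Cat-complete {t = t} odd bal))
    }
  }

lemma7p15 : (m : ℕ) → Odd m →
    (f : PFun Bool m) → InI Bool (Bal m) f ⇔ InI Bool (Cat m) f
lemma7p15 m odd f =
  ⇔-sym (InI⇔DeterminedBy (Cat-generates-Bal odd) f) ⇔-∘ InI⇔DeterminedBy (Bal-generates-Bal odd) f
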